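{- Let $G$ be a tree on $n$ vertices with diameter $D$ and let $P=v_0v_1\ldots v_D$ be a diametric path in $G$. If there is $j\leq D/2$ such that the degree of $v_k$ is at most $2$ for every $k\geq j+1$ ($k\le D$), then \[ ecc(P_n)-\rho(P_n)\geq ecc(G)-\rho(G), \] where $P_n$ is the path on $n$ vertices.
   Context: Graphs have $n\geq2$ vertices. $d(u,v)$ is the length of a shortest $u$–$v$ path. The eccentricity is $e(v)=\max_u d(v,u)$, the diameter is $D=\max_v e(v)$, and the average eccentricity is $ecc(G)=\frac1n\sum_v e(v)$. A diametric path is a shortest path between two vertices at distance $D$. The normalized transmission of $v$ is $\pi(v)=\frac{1}{n-1}\sum_u d(v,u)$ and the remoteness is $\rho(G)=\max_v\pi(v)$. -}

module Defs where

open import Data.Bool using (Bool; true; false; _∧_; _∨_; if_then_else_; T)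
open import Data.Nat using (ℕ; zero; suc; _+_; _*_; _≤_; _⊔_; NonZero)
open import Data.Fin using (Fin; toℕ; fromℕ; _≟_)
import Data.Fin as F
open import Data.List using (List; []; _∷_; foldr; map; length; allFin; last)
open import Data.Bool.ListAction using (any)
open import Data.Nat.ListAction using (sum)
open import Data.Bool.Properties using (∨-comm)
open import Data.List.Relation.Unary.Unique.Propositional using (Unique)
open import Data.List.Relation.Unary.Linked using (Linked)
open import Data.Maybe using (Maybe; just; nothing)
open import Data.Product using (Σ; ∃; _×_; _,_)
open import Relation.Binary.PropositionalEquality using (_≡_; _≢_; refl)
open import Relation.Nullary.Decidable using (⌊_⌋)
open import Data.Integer using (+_)
open import Data.Rational using (ℚ; _/_; 0ℚ)
import Data.Rational as Q

record Graph (n : ℕ) : Set where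
  field
    adj   : Fin n → Fin n → Bool
    sym   : ∀ u v → adj u v ≡ adj v u
    irrefl : ∀ v → adj v v ≡ false
open Graph public

module _ {n : ℕ} (G : Graph n) where

  Adj : Fin n → Fin n → Set
  Adj u v = T (adj G u v)

  reach : ℕ → Fin n → Fin n → Bool
  reach zero    u v = ⌊ u ≟ v ⌋
  reach (suc k) u v = reach k u v ∨ any (λ w → reach k u w ∧ adj G w v) (allFin n)

  Connected : Set
  Connected = ∀ u v → ∃ λ k → T (reach k u v)

  IsCycle : List (Fin n) → Set
  IsCycle []       = Data.Empty.⊥ where import Data.Empty
  IsCycle (x ∷ xs) =
    Unique (x ∷ xs) × (3 ≤ length (x ∷ xs)) × Linked Adj (x ∷ xs)
      × (∀ y → last (x ∷ xs) ≡ just y → Adj y x)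

  Acyclic : Set
  Acyclic = ∀ c → IsCycle c → Data.Empty.⊥ where import Data.Empty

  IsTree : Set
  IsTree = Connected × Acyclic

  -- d(u,v): least k ≤ n with a walk of length ≤ k from u to v
  -- (for connected graphs this is the length of a shortest u–v path; n is a dummy otherwise)
  distFrom : ℕ → ℕ → Fin n → Fin n → ℕ
  distFrom k zero    u v = k
  distFrom k (suc f) u v = if reach k u v then k else distFrom (suc k) f u v

  dist : Fin n → Fin n → ℕ
  dist u v = distFrom 0 n u v

  maxV : (Fin n → ℕ) → ℕ
  maxV f = foldr _⊔_ 0 (map f (allFin n))

  sumV : (Fin n → ℕ) → ℕ
  sumV f = sum (map f (allFin n))

  ecc : Fin n → ℕ
  ecc v = maxV (dist v)

  diam : ℕ
  diam = maxV ecc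

  deg : Fin n → ℕ
  deg v = sumV (λ w → if adj G v w then 1 else 0)

  trans : Fin n → ℕ
  trans v = sumV (dist v)

  IsDiametricPath : (p : Fin (suc diam) → Fin n) → Set
  IsDiametricPath p =
    (∀ (i : Fin diam) → Adj (p (F.inject₁ i)) (p (F.suc i)))
      × dist (p F.zero) (p (fromℕ diam)) ≡ diam

module _ {m : ℕ} (G : Graph (suc (suc m))) where

  avgEcc : ℚ
  avgEcc = (+ sumV G (ecc G)) / suc (suc m)

  normTrans : Fin (suc (suc m)) → ℚ
  normTrans v = (+ trans G v) / suc m

  remoteness : ℚ
  remoteness = foldr Q._⊔_ 0ℚ (map normTrans (allFin (suc (suc m))))

pathAdj : (n : ℕ) → Fin n → Fin n → Bool
pathAdj n i j = (suc (toℕ i) Data.Nat.≡ᵇ toℕ j) ∨ (suc (toℕ j) Data.Nat.≡ᵇ toℕ i)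

private
  suc≢ᵇ : ∀ k → (suc k Data.Nat.≡ᵇ k) ≡ false
  suc≢ᵇ zero = refl
  suc≢ᵇ (suc k) = suc≢ᵇ k

pathIrrefl : (n : ℕ) (v : Fin n) → pathAdj n v v ≡ false
pathIrrefl n v rewrite suc≢ᵇ (toℕ v) = refl

pathGraph : (n : ℕ) → Graph n
pathGraph n = record
  { adj    = pathAdj n
  ; sym    = λ u v → ∨-comm (suc (toℕ u) Data.Nat.≡ᵇ toℕ v) _
  ; irrefl = pathIrrefl n
  }

module Submission where

-- Let P = v₀ … v_D be a diametric path of the tree T on n = N + 1 vertices, and s = n - (D + 1) the
-- number of vertices off P. Walking along P, the distance to a fixed vertex u changes by ±1 at each
-- step and has no local maximum (that would give a vertex two parents in the breadth-first tree
-- rooted at u), so d(u, v_t) = h(u) + |t - i(u)|. Hence e(v_j) ≤ max(j, D - j), while e(u) ≤ D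
-- for every other u, giving Σ e ≤ Σ_{j ≤ D} max(j, D - j) + s D; and d(v₀, u) + d(v_D, u) = D + 2 h(u)
-- is at least D + 2 off P, so one of v₀, v_D has transmission at least (n D + 2 s) / 2, bounding ρ(T)
-- from below. For Pₙ, Σ e ≥ Σ_{j ≤ N} max(j, N - j) and every transmission is at most n N / 2.
-- Comparing the two bounds is a polynomial inequality in D and s, since
-- 3k² + 4k ≤ 4 Σ_{j ≤ k} max(j, k - j) ≤ 3k² + 4k + 1.

open import Defs hiding (sym) renaming (trans to transmission)
open import Data.Nat using (ℕ; suc; _*_; _≤_)
open import Data.Fin using (Fin; toℕ)
open import Data.Product using (∃; _×_)
open import Data.Rational using (_-_)
import Data.Rational as Q

open import Algebra.Construct.NaturalChoice.Base using (MaxOperator)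
import Algebra.Construct.NaturalChoice.MaxOp as MaxOp
open import Data.Bool using (true; false; if_then_else_; T; _∧_)
open import Data.Bool.Properties using (T-∨; T-∧)
open import Data.Fin as Fin using (zero; suc; _≟_)
import Data.Fin.Properties as Finₚ
import Data.Integer as ℤ
open import Data.List as List using (foldr; map; allFin; applyUpTo)
open import Data.List.Membership.Propositional using (_∈_)
open import Data.List.Membership.Propositional.Properties using (∈-map⁺; ∈-allFin)
open import Data.List.Properties using (map-tabulate; length-applyUpTo)
open import Data.List.Relation.Unary.All using (All; []; _∷_)
open import Data.List.Relation.Unary.All.Properties using (map⁺; tabulate⁺)
open import Data.List.Relation.Unary.Any as Any using (here; there; satisfied)
open import Data.List.Relation.Unary.Any.Properties using (any⁺; any⁻)
import Data.List.Relation.Unary.Linked.Properties as Linkedₚ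
import Data.List.Relation.Unary.Unique.Propositional.Properties as Uniqueₚ
open import Data.Maybe using (just)
open import Data.Maybe.Properties using (just-injective)
open import Data.Nat as ℕ using (zero; suc; _+_; _∸_; _⊔_; _<_; z≤n; s≤s; ∣_-_∣)
import Data.Nat.DivMod as ℕ÷
open import Data.Nat.GeneralisedArithmetic using (fold)
open import Data.Nat.Properties hiding (_≟_)
open import Data.Nat.Tactic.RingSolver using (solve-∀)
open import Data.Product using (_,_; proj₁; proj₂; Σ-syntax)
import Data.Rational.Properties as ℚₚ
open import Data.Sum using (_⊎_; inj₁; inj₂)
open import Data.Vec.Functional as Vector using (Vector)
open import Function using (_∘_; id; Equivalence)
open import Relation.Binary.Bundles using (TotalPreorder)
open import Relation.Binary.Definitions using (tri<; tri≈; tri>)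
open import Relation.Binary.PropositionalEquality
open import Relation.Nullary using (Dec; yes; no; does; ¬_)
open import Relation.Nullary.Decidable using (dec-true; dec-false; toWitness; fromWitness)
open import Relation.Nullary.Negation using (contradiction)

open import Algebra.Properties.Semiring.Sum +-*-semiring
  using (sum; sum-syntax; ∑-distrib-+; ∑-comm; sum-cong-≗; *-distribˡ-sum; sum-init-last)

m>n⇒m∸n≡1+[m∸1+n] : ∀ {m n} → n < m → m ∸ n ≡ suc (m ∸ suc n)
m>n⇒m∸n≡1+[m∸1+n] {suc m} (s≤s n≤m) = +-∸-assoc 1 n≤m

⊔-preserves : ∀ (Q : ℕ → Set) {a b} → Q a → Q b → Q (a ⊔ b)
⊔-preserves Q {a} {b} Qa Qb with ⊔-sel a b
... | inj₁ a⊔b≡a = subst Q (sym a⊔b≡a) Qa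
... | inj₂ a⊔b≡b = subst Q (sym a⊔b≡b) Qb

∣m-1+m∣≡1 : ∀ m → ∣ m - suc m ∣ ≡ 1
∣m-1+m∣≡1 m = trans (cong (∣ m -_∣) (+-comm 1 m)) (∣m-m+n∣≡n m 1)

last-applyUpTo : ∀ {A : Set} (F : ℕ → A) k → List.last (applyUpTo F (suc k)) ≡ just (F k)
last-applyUpTo F zero    = refl
last-applyUpTo F (suc k) = last-applyUpTo (F ∘ suc) k

module LastAgreement {n} (X Y : ℕ → Fin n) where

  lastAgreement : ℕ → ℕ
  lastAgreement zero    = zero
  lastAgreement (suc i) with X (suc i) ≟ Y (suc i)
  ... | yes _ = suc i
  ... | no  _ = lastAgreement i

  lastAgreement-agrees : X 0 ≡ Y 0 → ∀ i → X (lastAgreement i) ≡ Y (lastAgreement i)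
  lastAgreement-agrees X0≡Y0 zero = X0≡Y0
  lastAgreement-agrees X0≡Y0 (suc i) with X (suc i) ≟ Y (suc i)
  ... | yes e = e
  ... | no  _ = lastAgreement-agrees X0≡Y0 i

  lastAgreement-≤ : ∀ i → lastAgreement i ≤ i
  lastAgreement-≤ zero    = z≤n
  lastAgreement-≤ (suc i) with X (suc i) ≟ Y (suc i)
  ... | yes _ = ≤-refl
  ... | no  _ = m≤n⇒m≤1+n (lastAgreement-≤ i)

  lastAgreement-last : ∀ i {t} → lastAgreement i < t → t ≤ i → X t ≢ Y t
  lastAgreement-last zero    last<t t≤0 = contradiction t≤0 (<⇒≱ last<t)
  lastAgreement-last (suc i) {t} last<t t≤1+i with X (suc i) ≟ Y (suc i) | m≤n⇒m<n∨m≡n t≤1+i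
  ... | yes _      | _          = contradiction t≤1+i (<⇒≱ last<t)
  ... | no  Xi≢Yi | inj₂ refl  = Xi≢Yi
  ... | no  _      | inj₁ t<1+i = lastAgreement-last i last<t (≤-pred t<1+i)

-- A walk on ℕ with steps ±1 and no local maximum descends to its minimum and then ascends.
module Valley (φ : ℕ → ℕ) (D : ℕ)
  (step : ∀ {t} → t < D → φ (suc t) ≡ suc (φ t) ⊎ φ t ≡ suc (φ (suc t)))
  (no-peak : ∀ {t} → suc t < D → φ (suc t) ≡ suc (φ t) → φ (suc t) ≢ suc (φ (suc (suc t)))) where

  IsValley : ℕ → ℕ → Set
  IsValley j i = i ≤ j × (∀ {t} → t ≤ i → φ t ≡ φ i + (i ∸ t)) × (∀ {t} → i ≤ t → t ≤ j → φ t ≡ φ i + (t ∸ i))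

  ascend-valley : ∀ {i j} → IsValley j i → φ (suc j) ≡ suc (φ j) → IsValley (suc j) i
  ascend-valley {i} {j} (i≤j , down , up) rise = m≤n⇒m≤1+n i≤j , down , up′
    where
    up′ : ∀ {t} → i ≤ t → t ≤ suc j → φ t ≡ φ i + (t ∸ i)
    up′ i≤t t≤1+j with m≤n⇒m<n∨m≡n t≤1+j
    ... | inj₁ t≤j  = up i≤t (≤-pred t≤j)
    ... | inj₂ refl = begin
      φ (suc j)            ≡⟨ rise ⟩
      suc (φ j)            ≡⟨ cong suc (up i≤j ≤-refl) ⟩
      suc (φ i + (j ∸ i))  ≡⟨ +-suc (φ i) (j ∸ i) ⟨
      φ i + suc (j ∸ i)    ≡⟨ cong (φ i +_) (+-∸-assoc 1 i≤j) ⟨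
      φ i + (suc j ∸ i)    ∎
      where open ≡-Reasoning

  descend-valley : ∀ {i} → IsValley i i → φ i ≡ suc (φ (suc i)) → IsValley (suc i) (suc i)
  descend-valley {i} (_ , down , _) fall = ≤-refl , down′ , λ 1+i≤t t≤1+i → proj₂ (bottom (≤-antisym t≤1+i 1+i≤t))
    where
    bottom : ∀ {t} → t ≡ suc i → φ t ≡ φ (suc i) + (suc i ∸ t) × φ t ≡ φ (suc i) + (t ∸ suc i)
    bottom refl = let φ≡φ+0 = sym (trans (cong (φ (suc i) +_) (n∸n≡0 (suc i))) (+-identityʳ _)) in φ≡φ+0 , φ≡φ+0
    down′ : ∀ {t} → t ≤ suc i → φ t ≡ φ (suc i) + (suc i ∸ t)
    down′ {t} t≤1+i with m≤n⇒m<n∨m≡n t≤1+i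
    ... | inj₂ t≡1+i = proj₁ (bottom t≡1+i)
    ... | inj₁ t≤i   = begin
      φ t                        ≡⟨ down (≤-pred t≤i) ⟩
      φ i + (i ∸ t)              ≡⟨ cong (_+ (i ∸ t)) fall ⟩
      suc (φ (suc i)) + (i ∸ t)  ≡⟨ +-suc (φ (suc i)) (i ∸ t) ⟨
      φ (suc i) + suc (i ∸ t)    ≡⟨ cong (φ (suc i) +_) (+-∸-assoc 1 (≤-pred t≤i)) ⟨
      φ (suc i) + (suc i ∸ t)    ∎
      where open ≡-Reasoning

  no-descent-above-bottom : ∀ {i j} → IsValley j i → i < j → j < D → φ j ≢ suc (φ (suc j))
  no-descent-above-bottom {i} {suc j} (_ , _ , up) (s≤s i≤j) 1+j<D = no-peak 1+j<D (begin
    φ (suc j)             ≡⟨ up (m≤n⇒m≤1+n i≤j) ≤-refl ⟩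
    φ i + (suc j ∸ i)     ≡⟨ cong (φ i +_) (+-∸-assoc 1 i≤j) ⟩
    φ i + suc (j ∸ i)     ≡⟨ +-suc (φ i) (j ∸ i) ⟩
    suc (φ i + (j ∸ i))   ≡⟨ cong suc (up i≤j (n≤1+n j)) ⟨
    suc (φ j)             ∎)
    where open ≡-Reasoning

  valley-prefix : ∀ j → j ≤ D → ∃ (IsValley j)
  valley-prefix zero _ = 0 , z≤n , (λ { z≤n → sym (+-identityʳ _) }) , (λ { z≤n z≤n → sym (+-identityʳ _) })
  valley-prefix (suc j) j<D with valley-prefix j (<⇒≤ j<D) | step j<D
  ... | i , valley | inj₁ rise = i , ascend-valley valley rise
  ... | i , valley@(i≤j , _) | inj₂ fall with m≤n⇒m<n∨m≡n i≤j
  ...   | inj₂ refl = suc i , descend-valley valley fall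
  ...   | inj₁ i<j  = contradiction fall (no-descent-above-bottom valley i<j j<D)

  valley : ∃ (IsValley D)
  valley = valley-prefix D ≤-refl

foldr-map-allFin : ∀ {n} {A : Set} (_∙_ : A → A → A) (e : A) (f : Fin n → A) →
  foldr _∙_ e (map f (allFin n)) ≡ Vector.foldr _∙_ e f
foldr-map-allFin {n} _∙_ e f = trans (cong (foldr _∙_ e) (map-tabulate id f)) (foldr-tabulate f)
  where
  foldr-tabulate : ∀ {m} (g : Fin m → _) → foldr _∙_ e (List.tabulate g) ≡ Vector.foldr _∙_ e g
  foldr-tabulate {zero}  g = refl
  foldr-tabulate {suc m} g = cong (g zero ∙_) (foldr-tabulate (g ∘ suc))

sumV≡∑ : ∀ {n} (G : Graph n) (f : Fin n → ℕ) → sumV G f ≡ ∑[ u < n ] f u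
sumV≡∑ G = foldr-map-allFin _+_ 0

∑-mono-≤ : ∀ {n} {f g : Vector ℕ n} → (∀ i → f i ≤ g i) → sum f ≤ sum g
∑-mono-≤ {zero}  f≤g = z≤n
∑-mono-≤ {suc n} f≤g = +-mono-≤ (f≤g zero) (∑-mono-≤ (f≤g ∘ suc))

∑-const : ∀ n c → ∑[ i < n ] c ≡ n * c
∑-const zero    c = refl
∑-const (suc n) c = cong (c +_) (∑-const n c)

∑-triangular : ∀ r → 2 * ∑[ u < suc r ] toℕ u ≡ suc r * r
∑-triangular zero    = refl
∑-triangular (suc r) = begin
  2 * ∑[ u < suc r ] (1 + toℕ u)                ≡⟨ cong (2 *_) (∑-distrib-+ {suc r} (λ _ → 1) toℕ) ⟩
  2 * (∑[ u < suc r ] 1 + ∑[ u < suc r ] toℕ u)  ≡⟨ cong (λ x → 2 * (x + ∑[ u < suc r ] toℕ u)) (trans (∑-const (suc r) 1) (*-identityʳ (suc r))) ⟩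
  2 * (suc r + ∑[ u < suc r ] toℕ u)            ≡⟨ *-distribˡ-+ 2 (suc r) _ ⟩
  2 * suc r + 2 * ∑[ u < suc r ] toℕ u          ≡⟨ cong (2 * suc r +_) (∑-triangular r) ⟩
  2 * suc r + suc r * r                         ≡⟨ rearrange r ⟩
  suc (suc r) * suc r                           ∎
  where
  open ≡-Reasoning
  rearrange : ∀ r → 2 * suc r + suc r * r ≡ suc (suc r) * suc r
  rearrange = solve-∀

∑-∣-∣ : ∀ v r → 2 * ∑[ u < suc (v + r) ] ∣ v - toℕ u ∣ ≡ v * suc v + suc r * r
∑-∣-∣ zero    r = ∑-triangular r
∑-∣-∣ (suc v) r = begin
  2 * (suc v + ∑[ u < suc (v + r) ] ∣ v - toℕ u ∣)  ≡⟨ *-distribˡ-+ 2 (suc v) _ ⟩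
  2 * suc v + 2 * ∑[ u < suc (v + r) ] ∣ v - toℕ u ∣ ≡⟨ cong (2 * suc v +_) (∑-∣-∣ v r) ⟩
  2 * suc v + (v * suc v + suc r * r)               ≡⟨ rearrange v (suc r * r) ⟩
  suc v * suc (suc v) + suc r * r                   ∎
  where
  open ≡-Reasoning
  rearrange : ∀ v x → 2 * suc v + (v * suc v + x) ≡ suc v * suc (suc v) + x
  rearrange = solve-∀

∑-∣-∣-≤ : ∀ {v N} → v ≤ N → 2 * ∑[ u < suc N ] ∣ v - toℕ u ∣ ≤ suc N * N
∑-∣-∣-≤ {v} v≤N with m≤n⇒∃[o]m+o≡n v≤N
... | r , refl = begin
  2 * ∑[ u < suc (v + r) ] ∣ v - toℕ u ∣   ≡⟨ ∑-∣-∣ v r ⟩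
  v * suc v + suc r * r                   ≤⟨ m≤m+n _ (2 * v * r) ⟩
  v * suc v + suc r * r + 2 * v * r       ≡⟨ rearrange v r ⟩
  suc (v + r) * (v + r)                   ∎
  where
  open ≤-Reasoning
  rearrange : ∀ v r → v * suc v + suc r * r + 2 * v * r ≡ suc (v + r) * (v + r)
  rearrange = solve-∀

∑-restrict-empty : ∀ {k} {P : Fin k → Set} (P? : ∀ j → Dec (P j)) (g : Vector ℕ k) →
  (∀ j → ¬ P j) → ∑[ j < k ] (if does (P? j) then g j else 0) ≡ 0
∑-restrict-empty {k} P? g ¬P = begin
  ∑[ j < k ] (if does (P? j) then g j else 0) ≡⟨ sum-cong-≗ (λ j → cong (λ b → if b then g j else 0) (dec-false (P? j) (¬P j))) ⟩
  ∑[ j < k ] 0                                ≡⟨ ∑-const k 0 ⟩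
  k * 0                                       ≡⟨ *-zeroʳ k ⟩
  0                                           ∎
  where open ≡-Reasoning

∑-restrict-single : ∀ {k} {P : Fin k → Set} (P? : ∀ j → Dec (P j)) (g : Vector ℕ k) (a : Fin k) →
  P a → (∀ j → P j → j ≡ a) → ∑[ j < k ] (if does (P? j) then g j else 0) ≡ g a
∑-restrict-single {suc k} P? g zero Pa unique
  rewrite dec-true (P? zero) Pa
        | ∑-restrict-empty (P? ∘ suc) (g ∘ suc) (λ j Psj → Finₚ.0≢1+n (sym (unique (suc j) Psj))) = +-identityʳ (g zero)
∑-restrict-single {suc k} P? g (suc a) Pa unique
  rewrite dec-false (P? zero) (λ P0 → Finₚ.0≢1+n (unique zero P0)) =
  ∑-restrict-single (P? ∘ suc) (g ∘ suc) a Pa (λ j Psj → Finₚ.suc-injective (unique (suc j) Psj))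

∑-over-image : ∀ {k n} (ι : Fin k → Fin n) (π : Fin n → Fin k) → (∀ j → π (ι j) ≡ j) → (g : Vector ℕ k) →
  ∑[ u < n ] (if does (ι (π u) ≟ u) then g (π u) else 0) ≡ ∑[ j < k ] g j
∑-over-image {k} {n} ι π πι g = begin
  ∑[ u < n ] (if does (ι (π u) ≟ u) then g (π u) else 0)   ≡⟨ sum-cong-≗ image-indicator ⟩
  ∑[ u < n ] ∑[ j < k ] (if does (ι j ≟ u) then g j else 0) ≡⟨ ∑-comm (λ u j → if does (ι j ≟ u) then g j else 0) ⟩
  ∑[ j < k ] ∑[ u < n ] (if does (ι j ≟ u) then g j else 0) ≡⟨ sum-cong-≗ (λ j → ∑-restrict-single (ι j ≟_) (λ _ → g j) (ι j) refl (λ _ → sym)) ⟩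
  ∑[ j < k ] g j                                            ∎
  where
  open ≡-Reasoning
  image-indicator : ∀ u → (if does (ι (π u) ≟ u) then g (π u) else 0) ≡ ∑[ j < k ] (if does (ι j ≟ u) then g j else 0)
  image-indicator u with ι (π u) ≟ u
  ... | yes ιπu≡u = sym (∑-restrict-single (λ j → ι j ≟ u) g (π u) ιπu≡u (λ j ιj≡u → trans (sym (πι j)) (cong π ιj≡u)))
  ... | no ιπu≢u = sym (∑-restrict-empty (λ j → ι j ≟ u) g (λ j ιj≡u → ιπu≢u (trans (cong (ι ∘ π) (sym ιj≡u)) (trans (cong ι (πι j)) ιj≡u))))

module FoldrMax {a ℓ₁ ℓ₂} {O : TotalPreorder a ℓ₁ ℓ₂} (maxOp : MaxOperator O) where
  open TotalPreorder O using (_≲_) renaming (trans to ≲-trans)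
  open MaxOperator maxOp using () renaming (_⊔_ to _⊔ₒ_)
  private module M = MaxOp maxOp

  foldr-⊔-upper : ∀ {e x xs} → x ∈ xs → x ≲ foldr _⊔ₒ_ e xs
  foldr-⊔-upper (here refl)  = M.x≤x⊔y _ _
  foldr-⊔-upper (there x∈xs) = ≲-trans (foldr-⊔-upper x∈xs) (M.x≤y⊔x _ _)

  foldr-⊔-lub : ∀ {e b xs} → e ≲ b → All (_≲ b) xs → foldr _⊔ₒ_ e xs ≲ b
  foldr-⊔-lub e≲b []             = e≲b
  foldr-⊔-lub e≲b (x≲b ∷ xs≲b) = M.⊔-lub x≲b (foldr-⊔-lub e≲b xs≲b)

module _ {n} (G : Graph n) where
  open FoldrMax ⊔-operator

  maxV-upper : ∀ (f : Fin n → ℕ) u → f u ≤ maxV G f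
  maxV-upper f u = foldr-⊔-upper (∈-map⁺ f (∈-allFin u))

  maxV-lub : ∀ {f : Fin n → ℕ} {b} → (∀ u → f u ≤ b) → maxV G f ≤ b
  maxV-lub f≤b = foldr-⊔-lub z≤n (map⁺ (tabulate⁺ f≤b))

module _ {m} (G : Graph (suc (suc m))) where
  open FoldrMax ℚₚ.⊔-operator

  normTrans≤remoteness : ∀ u → normTrans G u Q.≤ remoteness G
  normTrans≤remoteness u = foldr-⊔-upper (∈-map⁺ (normTrans G) (∈-allFin u))

  remoteness-lub : ∀ {b} → Q.0ℚ Q.≤ b → (∀ u → normTrans G u Q.≤ b) → remoteness G Q.≤ b
  remoteness-lub 0≤b π≤b = foldr-⊔-lub 0≤b (map⁺ {f = normTrans G} (tabulate⁺ {f = id} π≤b))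

-- The sum of the eccentricities of the path on k + 1 vertices.
pathEccSum : ℕ → ℕ
pathEccSum k = ∑[ j < suc k ] (toℕ j ⊔ (k ∸ toℕ j))

pathEccSum-step : ∀ k → pathEccSum (suc (suc k)) ≡ pathEccSum k + (3 * k + 5)
pathEccSum-step k = begin
  suc (suc k) + ∑[ j < suc (suc k) ] inner (toℕ j)
    ≡⟨ cong (suc (suc k) +_) (sum-init-last {suc k} (inner ∘ toℕ)) ⟩
  suc (suc k) + (∑[ j < suc k ] inner (toℕ (Fin.inject₁ j)) + inner (toℕ (Fin.fromℕ (suc k))))
    ≡⟨ cong₂ (λ x y → suc (suc k) + (x + y)) middle outer ⟩
  suc (suc k) + ((suc k + pathEccSum k) + suc (suc k))
    ≡⟨ regroup k (pathEccSum k) ⟩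
  pathEccSum k + (3 * k + 5)
    ∎
  where
  open ≡-Reasoning
  inner : ℕ → ℕ
  inner j = suc j ⊔ (suc k ∸ j)
  middle : ∑[ j < suc k ] inner (toℕ (Fin.inject₁ j)) ≡ suc k + pathEccSum k
  middle = begin
    ∑[ j < suc k ] inner (toℕ (Fin.inject₁ j))             ≡⟨ sum-cong-≗ {suc k} (λ j → cong inner (Finₚ.toℕ-inject₁ j)) ⟩
    ∑[ j < suc k ] (suc (toℕ j) ⊔ (suc k ∸ toℕ j))        ≡⟨ sum-cong-≗ {suc k} (λ j → cong (suc (toℕ j) ⊔_) (+-∸-assoc 1 (Finₚ.toℕ≤pred[n] j))) ⟩
    ∑[ j < suc k ] (1 + (toℕ j ⊔ (k ∸ toℕ j)))            ≡⟨ ∑-distrib-+ {suc k} (λ _ → 1) (λ j → toℕ j ⊔ (k ∸ toℕ j)) ⟩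
    ∑[ j < suc k ] 1 + pathEccSum k                       ≡⟨ cong (_+ pathEccSum k) (trans (∑-const (suc k) 1) (*-identityʳ (suc k))) ⟩
    suc k + pathEccSum k                                  ∎
  outer : inner (toℕ (Fin.fromℕ (suc k))) ≡ suc (suc k)
  outer rewrite Finₚ.toℕ-fromℕ k | n∸n≡0 k = ⊔-identityʳ (suc (suc k))
  regroup : ∀ k e → suc (suc k) + ((suc k + e) + suc (suc k)) ≡ e + (3 * k + 5)
  regroup = solve-∀

pathEccSum-bounds : ∀ k → 3 * k * k + 4 * k ≤ 4 * pathEccSum k × 4 * pathEccSum k ≤ 3 * k * k + 4 * k + 1
pathEccSum-bounds zero          = z≤n , z≤n
pathEccSum-bounds (suc zero)    = n≤1+n 7 , ≤-refl
pathEccSum-bounds (suc (suc k)) = lower , upper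
  where
  open ≤-Reasoning
  four-steps : 4 * pathEccSum (suc (suc k)) ≡ 4 * pathEccSum k + 4 * (3 * k + 5)
  four-steps = trans (cong (4 *_) (pathEccSum-step k)) (*-distribˡ-+ 4 (pathEccSum k) (3 * k + 5))
  shift : ∀ k → 3 * suc (suc k) * suc (suc k) + 4 * suc (suc k) ≡ 3 * k * k + 4 * k + 4 * (3 * k + 5)
  shift = solve-∀
  shift+1 : ∀ k → 3 * k * k + 4 * k + 1 + 4 * (3 * k + 5) ≡ 3 * suc (suc k) * suc (suc k) + 4 * suc (suc k) + 1
  shift+1 = solve-∀
  lower : 3 * suc (suc k) * suc (suc k) + 4 * suc (suc k) ≤ 4 * pathEccSum (suc (suc k))
  lower = begin
    3 * suc (suc k) * suc (suc k) + 4 * suc (suc k)  ≡⟨ shift k ⟩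
    3 * k * k + 4 * k + 4 * (3 * k + 5)              ≤⟨ +-monoˡ-≤ _ (proj₁ (pathEccSum-bounds k)) ⟩
    4 * pathEccSum k + 4 * (3 * k + 5)               ≡⟨ four-steps ⟨
    4 * pathEccSum (suc (suc k))                     ∎
  upper : 4 * pathEccSum (suc (suc k)) ≤ 3 * suc (suc k) * suc (suc k) + 4 * suc (suc k) + 1
  upper = begin
    4 * pathEccSum (suc (suc k))                     ≡⟨ four-steps ⟩
    4 * pathEccSum k + 4 * (3 * k + 5)               ≤⟨ +-monoˡ-≤ _ (proj₂ (pathEccSum-bounds k)) ⟩
    3 * k * k + 4 * k + 1 + 4 * (3 * k + 5)          ≡⟨ shift+1 k ⟩
    3 * suc (suc k) * suc (suc k) + 4 * suc (suc k) + 1  ∎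

-- Multiplied out by 2 N n, where N = D + s and n = N + 1: the upper bound
-- (pathEccSum D + s D) / n - (n D + 2 s) / 2 N on ecc - ρ for a tree of diameter D with s vertices off
-- a diametric path is at most the lower bound pathEccSum N / n - n / 2 on ecc(Pₙ) - ρ(Pₙ).
spine-bound≤path-bound : ∀ D s →
  2 * (D + s) * (pathEccSum D + s * D) + suc (D + s) * (suc (D + s) * (D + s))
    ≤ 2 * (D + s) * pathEccSum (D + s) + suc (D + s) * (suc (D + s) * D + 2 * s)
spine-bound≤path-bound D zero rewrite +-identityʳ D = ≤-reflexive (no-spine D (pathEccSum D))
  where
  no-spine : ∀ D a → 2 * D * (a + 0 * D) + suc D * (suc D * D) ≡ 2 * D * a + suc D * (suc D * D + 2 * 0)
  no-spine = solve-∀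
spine-bound≤path-bound D s@(suc t) = *-cancelˡ-≤ 4 (begin
  4 * (2 * N * (a + s * D) + n * (n * N))            ≡⟨ expand-left D t a ⟩
  2 * N * (4 * a) + (8 * N * s * D + 4 * n * n * N)  ≤⟨ +-monoˡ-≤ _ (*-monoʳ-≤ (2 * N) (proj₂ (pathEccSum-bounds D))) ⟩
  2 * N * (3 * D * D + 4 * D + 1) + (8 * N * s * D + 4 * n * n * N)
                                                     ≤⟨ m≤m+n _ (2 * N * s * s + 4 * s + 8 * N * t + 6 * N) ⟩
  2 * N * (3 * D * D + 4 * D + 1) + (8 * N * s * D + 4 * n * n * N) + (2 * N * s * s + 4 * s + 8 * N * t + 6 * N)
                                                     ≡⟨ slack D t ⟩
  2 * N * (3 * N * N + 4 * N) + 4 * n * (n * D + 2 * s)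
                                                     ≤⟨ +-monoˡ-≤ _ (*-monoʳ-≤ (2 * N) (proj₁ (pathEccSum-bounds N))) ⟩
  2 * N * (4 * c) + 4 * n * (n * D + 2 * s)          ≡⟨ expand-right D t c ⟩
  4 * (2 * N * c + n * (n * D + 2 * s))              ∎)
  where
  open ≤-Reasoning
  N = D + s
  n = suc N
  a = pathEccSum D
  c = pathEccSum N
  expand-left : ∀ D t a → 4 * (2 * (D + suc t) * (a + suc t * D) + suc (D + suc t) * (suc (D + suc t) * (D + suc t)))
                        ≡ 2 * (D + suc t) * (4 * a) + (8 * (D + suc t) * suc t * D + 4 * suc (D + suc t) * suc (D + suc t) * (D + suc t))
  expand-left = solve-∀
  slack : ∀ D t → let N = D + suc t ; n = suc N ; s = suc t in
    2 * N * (3 * D * D + 4 * D + 1) + (8 * N * s * D + 4 * n * n * N) + (2 * N * s * s + 4 * s + 8 * N * t + 6 * N)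
      ≡ 2 * N * (3 * N * N + 4 * N) + 4 * n * (n * D + 2 * s)
  slack = solve-∀
  expand-right : ∀ D t c → 2 * (D + suc t) * (4 * c) + 4 * suc (D + suc t) * (suc (D + suc t) * D + 2 * suc t)
                         ≡ 4 * (2 * (D + suc t) * c + suc (D + suc t) * (suc (D + suc t) * D + 2 * suc t))
  expand-right = solve-∀

cross-multiplied-bound : ∀ {D s N SE SP t x} → D + s ≡ N →
  SE ≤ pathEccSum D + s * D → pathEccSum N ≤ SP → suc N * D + 2 * s ≤ 2 * t → 2 * x ≤ suc N * N →
  SE * N + x * suc N ≤ SP * N + t * suc N
cross-multiplied-bound {D} {s} {SE = SE} {SP} {t} {x} refl SE≤ SP≥ 2t≥ 2x≤ = *-cancelˡ-≤ 2 (begin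
  2 * (SE * N + x * n)                      ≡⟨ expand-left SE N x ⟩
  2 * N * SE + n * (2 * x)                  ≤⟨ +-mono-≤ (*-monoʳ-≤ (2 * N) SE≤) (*-monoʳ-≤ n 2x≤) ⟩
  2 * N * (pathEccSum D + s * D) + n * (n * N)
                                            ≤⟨ spine-bound≤path-bound D s ⟩
  2 * N * pathEccSum N + n * (n * D + 2 * s) ≤⟨ +-mono-≤ (*-monoʳ-≤ (2 * N) SP≥) (*-monoʳ-≤ n 2t≥) ⟩
  2 * N * SP + n * (2 * t)                  ≡⟨ expand-left SP N t ⟨
  2 * (SP * N + t * n)                      ∎)
  where
  open ≤-Reasoning
  N = D + s
  n = suc N
  expand-left : ∀ a N b → 2 * (a * N + b * suc N) ≡ 2 * N * a + suc N * (2 * b)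
  expand-left = solve-∀

module Fractions where
  open import Data.Integer as ℤ using (+_; +≤+)
  import Data.Integer.Properties as ℤₚ
  open import Data.Rational using (0ℚ; _/_; toℚᵘ)
  open ℚₚ using (toℚᵘ-cancel-≤; toℚᵘ-fromℚᵘ; toℚᵘ-homo-+; 0/n≡0)
  open import Data.Rational.Solver using (module +-*-Solver)
  open import Data.Rational.Unnormalised as ℚᵘ using (mkℚᵘ; _≃_; *≤*)
  import Data.Rational.Unnormalised.Properties as ℚᵘₚ

  private
    toℚᵘ-/ : ∀ a d → toℚᵘ ((+ a) / suc d) ≃ mkℚᵘ (+ a) d
    toℚᵘ-/ a d = toℚᵘ-fromℚᵘ (mkℚᵘ (+ a) d)

    toℚᵘ-/+/ : ∀ a b d e → toℚᵘ ((+ a) / suc d Q.+ (+ b) / suc e) ≃ mkℚᵘ (+ a) d ℚᵘ.+ mkℚᵘ (+ b) e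
    toℚᵘ-/+/ a b d e = ℚᵘₚ.≃-trans (toℚᵘ-homo-+ ((+ a) / suc d) ((+ b) / suc e)) (ℚᵘₚ.+-cong (toℚᵘ-/ a d) (toℚᵘ-/ b e))

  /-monoˡ-≤ : ∀ {x y} d → x ≤ y → (+ x) / suc d Q.≤ (+ y) / suc d
  /-monoˡ-≤ {x} {y} d x≤y = toℚᵘ-cancel-≤ (ℚᵘₚ.≤-respˡ-≃ (ℚᵘₚ.≃-sym (toℚᵘ-/ x d)) (ℚᵘₚ.≤-respʳ-≃ (ℚᵘₚ.≃-sym (toℚᵘ-/ y d))
    (*≤* (ℤₚ.*-monoʳ-≤-nonNeg (+ suc d) (+≤+ x≤y)))))

  0≤/ : ∀ x d → 0ℚ Q.≤ (+ x) / suc d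
  0≤/ x d = subst (Q._≤ (+ x) / suc d) (0/n≡0 (suc d)) (/-monoˡ-≤ {0} {x} d z≤n)

  /+/-mono-≤ : ∀ {a b c f} d e → a * suc e + b * suc d ≤ c * suc e + f * suc d →
               (+ a) / suc d Q.+ (+ b) / suc e Q.≤ (+ c) / suc d Q.+ (+ f) / suc e
  /+/-mono-≤ {a} {b} {c} {f} d e ineq = toℚᵘ-cancel-≤ (ℚᵘₚ.≤-respˡ-≃ (ℚᵘₚ.≃-sym (toℚᵘ-/+/ a b d e))
    (ℚᵘₚ.≤-respʳ-≃ (ℚᵘₚ.≃-sym (toℚᵘ-/+/ c f d e)) (*≤* (ℤₚ.*-monoʳ-≤-nonNeg (+ (suc d * suc e)) (embed ineq)))))
    where
    as-ℤ : ∀ x y → + x ℤ.* + suc e ℤ.+ + y ℤ.* + suc d ≡ + (x * suc e + y * suc d)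
    as-ℤ x y = trans (cong₂ ℤ._+_ (sym (ℤₚ.pos-* x (suc e))) (sym (ℤₚ.pos-* y (suc d)))) (sym (ℤₚ.pos-+ (x * suc e) (y * suc d)))
    embed : a * suc e + b * suc d ≤ c * suc e + f * suc d →
            + a ℤ.* + suc e ℤ.+ + b ℤ.* + suc d ℤ.≤ + c ℤ.* + suc e ℤ.+ + f ℤ.* + suc d
    embed ineq = subst₂ ℤ._≤_ (sym (as-ℤ a b)) (sym (as-ℤ c f)) (+≤+ ineq)

  −-swap-≤ : ∀ p q r s → p Q.+ s Q.≤ r Q.+ q → p Q.- q Q.≤ r Q.- s
  −-swap-≤ p q r s ineq = subst₂ Q._≤_ (cancel p q s) (cancel′ r s q) (ℚₚ.+-monoˡ-≤ (Q.- q Q.- s) ineq)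
    where
    open +-*-Solver
    cancel : ∀ a b c → (a Q.+ c) Q.+ (Q.- b Q.- c) ≡ a Q.- b
    cancel = solve 3 (λ a b c → (a :+ c) :+ (:- b :- c) := a :- b) refl
    cancel′ : ∀ a b c → (a Q.+ c) Q.+ (Q.- c Q.- b) ≡ a Q.- b
    cancel′ = solve 3 (λ a b c → (a :+ c) :+ (:- c :- b) := a :- b) refl

  difference-mono-≤ : ∀ {a b c f} d e {ρ σ} → a * suc e + b * suc d ≤ c * suc e + f * suc d →
                      (+ f) / suc e Q.≤ ρ → σ Q.≤ (+ b) / suc e → (+ a) / suc d Q.- ρ Q.≤ (+ c) / suc d Q.- σ
  difference-mono-≤ {a} {b} {c} {f} d e {ρ} {σ} ineq f≤ρ σ≤b = begin
    (+ a) / suc d Q.- ρ               ≤⟨ ℚₚ.+-monoʳ-≤ ((+ a) / suc d) (ℚₚ.neg-antimono-≤ f≤ρ) ⟩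
    (+ a) / suc d Q.- (+ f) / suc e   ≤⟨ −-swap-≤ ((+ a) / suc d) ((+ f) / suc e) ((+ c) / suc d) ((+ b) / suc e) (/+/-mono-≤ {a} {b} {c} {f} d e ineq) ⟩
    (+ c) / suc d Q.- (+ b) / suc e   ≤⟨ ℚₚ.+-monoʳ-≤ ((+ c) / suc d) (ℚₚ.neg-antimono-≤ σ≤b) ⟩
    (+ c) / suc d Q.- σ               ∎
    where open ℚₚ.≤-Reasoning

module Walks {n} (G : Graph n) where

  -- A record around T (reach G k u v), so that k, u and v can be inferred from it.
  record Reach (k : ℕ) (u v : Fin n) : Set where
    constructor reachᵀ
    field unreach : T (reach G k u v)
  open Reach

  adj-sym : ∀ {u v} → Adj G u v → Adj G v u
  adj-sym {u} {v} = subst T (Graph.sym G u v)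

  reach-refl : ∀ {u} → Reach 0 u u
  reach-refl = reachᵀ (fromWitness refl)

  reach-zero⁻ : ∀ {u v} → Reach 0 u v → u ≡ v
  reach-zero⁻ (reachᵀ r) = toWitness r

  reach-suc : ∀ {k u v} → Reach k u v → Reach (suc k) u v
  reach-suc (reachᵀ r) = reachᵀ (Equivalence.from T-∨ (inj₁ r))

  reach-step : ∀ {k u w v} → Reach k u w → Adj G w v → Reach (suc k) u v
  reach-step {w = w} (reachᵀ r) w~v =
    reachᵀ (Equivalence.from T-∨ (inj₂ (any⁺ _ (Any.map (λ { refl → Equivalence.from T-∧ (r , w~v) }) (∈-allFin w)))))

  reach-suc⁻ : ∀ {k u v} → Reach (suc k) u v → Reach k u v ⊎ ∃ λ w → Reach k u w × Adj G w v
  reach-suc⁻ {k} {u} {v} (reachᵀ r) with Equivalence.to T-∨ r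
  ... | inj₁ r′ = inj₁ (reachᵀ r′)
  ... | inj₂ r′ with satisfied (any⁻ (λ w → reach G k u w ∧ adj G w v) (allFin n) r′)
  ... | w , rw = let r″ , w~v = Equivalence.to T-∧ rw in inj₂ (w , reachᵀ r″ , w~v)

  reach-adj : ∀ {u v} → Adj G u v → Reach 1 u v
  reach-adj = reach-step reach-refl

  reach-trans : ∀ {k l u v w} → Reach k u v → Reach l v w → Reach (k + l) u w
  reach-trans {k} {zero} {u} r s
    rewrite reach-zero⁻ s = subst (λ i → Reach i u _) (sym (+-identityʳ k)) r
  reach-trans {k} {suc l} r s rewrite +-suc k l with reach-suc⁻ s
  ... | inj₁ s′            = reach-suc (reach-trans r s′)
  ... | inj₂ (x , s′ , x~w) = reach-step (reach-trans r s′) x~w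

  reach-sym : ∀ {k u v} → Reach k u v → Reach k v u
  reach-sym {zero} r rewrite reach-zero⁻ r = reach-refl
  reach-sym {suc k} r with reach-suc⁻ r
  ... | inj₁ r′            = reach-suc (reach-sym r′)
  ... | inj₂ (w , r′ , w~v) = reach-trans (reach-adj (adj-sym w~v)) (reach-sym r′)

  distFrom-≤ : ∀ k f {u v j} → k ≤ j → Reach j u v → distFrom G k f u v ≤ j
  distFrom-≤ k zero    k≤j r = k≤j
  distFrom-≤ k (suc f) {u} {v} k≤j r with reach G k u v in eq
  ... | true  = k≤j
  ... | false = distFrom-≤ (suc k) f (≤∧≢⇒< k≤j λ { refl → subst T eq (unreach r) }) r

  distFrom-reach : ∀ k f {u v j} → k ≤ j → j < k + f → Reach j u v → Reach (distFrom G k f u v) u v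
  distFrom-reach k zero    k≤j j<k+0 r = contradiction (≤-trans j<k+0 (≤-reflexive (+-identityʳ k))) (≤⇒≯ k≤j)
  distFrom-reach k (suc f) {u} {v} {j} k≤j j<k+f r with reach G k u v in eq
  ... | true  = reachᵀ (subst T (sym eq) _)
  ... | false = distFrom-reach (suc k) f (≤∧≢⇒< k≤j λ { refl → subst T eq (unreach r) })
                  (subst (j <_) (+-suc k f) j<k+f) r

  dist-≤ : ∀ {u v j} → Reach j u v → dist G u v ≤ j
  dist-≤ = distFrom-≤ 0 n z≤n

module Distances {n} (G : Graph n) (connected : Connected G) where
  open Walks G public

  module ShortestWalks (ℓ : Fin n → Fin n → ℕ) (reach-ℓ : ∀ u v → Reach (ℓ u v) u v)
                       (ℓ-≤ : ∀ {u v j} → Reach j u v → ℓ u v ≤ j) where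

    ℓ-pred : ∀ {u x i} → ℓ u x ≡ suc i → ∃ λ y → Adj G y x × ℓ u y ≡ i
    ℓ-pred {u} {x} {i} ℓux≡1+i with reach-suc⁻ (subst (λ k → Reach k u x) ℓux≡1+i (reach-ℓ u x))
    ... | inj₁ r = contradiction (≤-trans (≤-reflexive (sym ℓux≡1+i)) (ℓ-≤ r)) (n≮n i)
    ... | inj₂ (y , r , y~x) = y , y~x , ≤-antisym (ℓ-≤ r) (≤-pred i≤ℓuy)
      where
      i≤ℓuy : suc i ≤ suc (ℓ u y)
      i≤ℓuy = subst (_≤ suc (ℓ u y)) ℓux≡1+i (ℓ-≤ (reach-step (reach-ℓ u y) y~x))

    ℓ-intermediate : ∀ {u x} t → t ≤ ℓ u x → ∃ λ y → ℓ u y ≡ t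
    ℓ-intermediate {u} {x} t t≤ℓ = go (ℓ u x) x refl t≤ℓ
      where
      go : ∀ k x → ℓ u x ≡ k → t ≤ k → ∃ λ y → ℓ u y ≡ t
      go k x ℓux≡k t≤k with m≤n⇒m<n∨m≡n t≤k
      ... | inj₂ refl = x , ℓux≡k
      ... | inj₁ t<k with k | ℓux≡k
      ...   | suc k′ | ℓux≡1+k′ = let y , _ , ℓuy≡k′ = ℓ-pred ℓux≡1+k′ in go k′ y ℓuy≡k′ (≤-pred t<k)

    -- Vertices at the levels 0, …, ℓ u v are pairwise distinct.
    ℓ<n : ∀ u v → ℓ u v < n
    ℓ<n u v = Finₚ.injective⇒≤ {f = at-level} at-level-injective
      where
      at-level : Fin (suc (ℓ u v)) → Fin n
      at-level t = proj₁ (ℓ-intermediate (toℕ t) (Finₚ.toℕ≤pred[n] t))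
      at-level-injective : ∀ {s t} → at-level s ≡ at-level t → s ≡ t
      at-level-injective {s} {t} e = Finₚ.toℕ-injective (begin
        toℕ s              ≡⟨ proj₂ (ℓ-intermediate (toℕ s) (Finₚ.toℕ≤pred[n] s)) ⟨
        ℓ u (at-level s)   ≡⟨ cong (ℓ u) e ⟩
        ℓ u (at-level t)   ≡⟨ proj₂ (ℓ-intermediate (toℕ t) (Finₚ.toℕ≤pred[n] t)) ⟩
        toℕ t              ∎)
        where open ≡-Reasoning

  private
    level : Fin n → Fin n → ℕ
    level u v = distFrom G 0 (suc (proj₁ (connected u v))) u v

    reach-level : ∀ u v → Reach (level u v) u v
    reach-level u v = distFrom-reach 0 _ {j = proj₁ (connected u v)} z≤n ≤-refl (reachᵀ (proj₂ (connected u v)))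

    level-≤ : ∀ {u v j} → Reach j u v → level u v ≤ j
    level-≤ {u} {v} = distFrom-≤ 0 (suc (proj₁ (connected u v))) z≤n

    open ShortestWalks level reach-level level-≤ using () renaming (ℓ<n to level<n)

  reach-dist : ∀ u v → Reach (dist G u v) u v
  reach-dist u v = distFrom-reach 0 n z≤n (level<n u v) (reach-level u v)

  open ShortestWalks (dist G) reach-dist dist-≤ using () renaming (ℓ-pred to dist-pred) public

  dist-refl : ∀ u → dist G u u ≡ 0
  dist-refl u = n≤0⇒n≡0 (dist-≤ reach-refl)

  dist≡0⇒≡ : ∀ {u v} → dist G u v ≡ 0 → u ≡ v
  dist≡0⇒≡ {u} {v} d≡0 = reach-zero⁻ (subst (λ k → Reach k u v) d≡0 (reach-dist u v))

  dist-sym : ∀ u v → dist G u v ≡ dist G v u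
  dist-sym u v = ≤-antisym (dist-≤ (reach-sym (reach-dist v u))) (dist-≤ (reach-sym (reach-dist u v)))

  dist-triangle : ∀ u v w → dist G u w ≤ dist G u v + dist G v w
  dist-triangle u v w = dist-≤ (reach-trans (reach-dist u v) (reach-dist v w))

  dist-adj : ∀ {u v} → Adj G u v → dist G u v ≤ 1
  dist-adj u~v = dist-≤ (reach-adj u~v)

module Trees {n} (G : Graph n) (tree : IsTree G) where
  open Distances G (proj₁ tree) public

  sequence-not-closed : ∀ (F : ℕ → Fin n) {k} → 2 ≤ k → (∀ {s t} → s < t → t < suc k → F s ≢ F t) →
                        (∀ {t} → suc t < suc k → Adj G (F t) (F (suc t))) → ¬ Adj G (F k) (F 0)
  sequence-not-closed F {k} 2≤k F-injective F-linked Fk~F0 =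
    proj₂ tree (applyUpTo F (suc k))
      (Uniqueₚ.applyUpTo⁺₁ F (suc k) F-injective , long , Linkedₚ.applyUpTo⁺₁ F (suc k) F-linked , closed)
    where
    long : 3 ≤ List.length (applyUpTo F (suc k))
    long = subst (3 ≤_) (sym (length-applyUpTo F (suc k))) (s≤s 2≤k)
    closed : ∀ y → List.last (applyUpTo F (suc k)) ≡ just y → Adj G y (F 0)
    closed y last≡y = subst (λ z → Adj G z (F 0)) (just-injective (trans (sym (last-applyUpTo F k)) last≡y)) Fk~F0

  module Rooted (v : Fin n) where

    level : Fin n → ℕ
    level = dist G v

    private
      parentAt : ∀ x k → level x ≡ k → Fin n
      parentAt x zero    _     = x
      parentAt x (suc i) ℓx≡k = proj₁ (dist-pred ℓx≡k)

      parentAt-spec : ∀ x k (ℓx≡k : level x ≡ k) {i} → k ≡ suc i →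
                      Adj G (parentAt x k ℓx≡k) x × level (parentAt x k ℓx≡k) ≡ i
      parentAt-spec x (suc i) ℓx≡k refl = proj₂ (dist-pred ℓx≡k)

    parent : Fin n → Fin n
    parent x = parentAt x (level x) refl

    parent-adj-level : ∀ {x i} → level x ≡ suc i → Adj G (parent x) x × level (parent x) ≡ i
    parent-adj-level {x} = parentAt-spec x (level x) refl

    ancestor : ℕ → Fin n → Fin n
    ancestor j x = fold x parent j

    ancestor-level : ∀ {j x} → j ≤ level x → level (ancestor j x) ≡ level x ∸ j
    ancestor-level {zero}  _ = refl
    ancestor-level {suc j} {x} j<ℓx = proj₂ (parent-adj-level (trans (ancestor-level (<⇒≤ j<ℓx)) (m>n⇒m∸n≡1+[m∸1+n] j<ℓx)))

    geodesic : Fin n → ℕ → Fin n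
    geodesic x i = ancestor (level x ∸ i) x

    geodesic-level : ∀ {x i} → i ≤ level x → level (geodesic x i) ≡ i
    geodesic-level {x} {i} i≤ℓx = trans (ancestor-level (m∸n≤m (level x) i)) (m∸[m∸n]≡n i≤ℓx)

    geodesic-adj : ∀ {x i} → i < level x → Adj G (geodesic x i) (geodesic x (suc i))
    geodesic-adj {x} {i} i<ℓx rewrite m>n⇒m∸n≡1+[m∸1+n] i<ℓx = proj₁ (parent-adj-level (geodesic-level i<ℓx))

    geodesic-end : ∀ x → geodesic x (level x) ≡ x
    geodesic-end x = cong (λ j → ancestor j x) (n∸n≡0 (level x))

    private
      module Fork {X Y : ℕ → Fin n} {a b : ℕ}
                  (X-level : ∀ {i} → i ≤ a → level (X i) ≡ i) (Y-level : ∀ {i} → i ≤ b → level (Y i) ≡ i)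
                  (X-adj : ∀ {i} → i < a → Adj G (X i) (X (suc i)))
                  (Y-adj : ∀ {i} → i < b → Adj G (Y i) (Y (suc i)))
                  (b≤a : b ≤ a) (Xb≢Yb : X b ≢ Y b) where
        open LastAgreement X Y

        j : ℕ
        j = lastAgreement b

        Xj≡Yj : X j ≡ Y j
        Xj≡Yj = lastAgreement-agrees (trans (sym (dist≡0⇒≡ (X-level z≤n))) (dist≡0⇒≡ (Y-level z≤n))) b

        j<b : j < b
        j<b with m≤n⇒m<n∨m≡n (lastAgreement-≤ b)
        ... | inj₁ j<b = j<b
        ... | inj₂ j≡b = contradiction (subst (λ i → X i ≡ Y i) j≡b Xj≡Yj) Xb≢Yb

        K L : ℕ
        K = a ∸ j
        L = b ∸ j

        -- The cycle runs down X from X a to X j = Y j, then up Y to Y b.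
        cycle : ℕ → Fin n
        cycle t with t ≤? K
        ... | yes _ = X (a ∸ t)
        ... | no  _ = Y (j + (t ∸ K))

        cycle-down : ∀ {t} → t ≤ K → cycle t ≡ X (a ∸ t)
        cycle-down {t} t≤K with t ≤? K
        ... | yes _   = refl
        ... | no  t≰K = contradiction t≤K t≰K

        cycle-up : ∀ {t} → K < t → cycle t ≡ Y (j + (t ∸ K))
        cycle-up {t} K<t with t ≤? K
        ... | yes t≤K = contradiction t≤K (<⇒≱ K<t)
        ... | no  _   = refl

        j≤a : j ≤ a
        j≤a = ≤-trans (<⇒≤ j<b) b≤a

        K≤a : K ≤ a
        K≤a = m∸n≤m a j

        up-index : ∀ {t} → t ≤ K + L → j + (t ∸ K) ≤ b
        up-index {t} t≤K+L = begin
          j + (t ∸ K)      ≤⟨ +-monoʳ-≤ j (∸-monoˡ-≤ K t≤K+L) ⟩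
          j + (K + L ∸ K)  ≡⟨ cong (j +_) (m+n∸m≡n K L) ⟩
          j + L            ≡⟨ m+[n∸m]≡n (<⇒≤ j<b) ⟩
          b                ∎
          where open ≤-Reasoning

        level-down : ∀ {t} → t ≤ K → level (cycle t) ≡ a ∸ t
        level-down {t} t≤K = trans (cong level (cycle-down t≤K)) (X-level (m∸n≤m a t))

        level-up : ∀ {t} → K < t → t ≤ K + L → level (cycle t) ≡ j + (t ∸ K)
        level-up K<t t≤K+L = trans (cong level (cycle-up K<t)) (Y-level (up-index t≤K+L))

        cycle-injective : ∀ {s t} → s < t → t < suc (K + L) → cycle s ≢ cycle t
        cycle-injective {s} {t} s<t t<1+K+L cs≡ct with ≤-<-connex s K | ≤-<-connex t K
        ... | inj₁ s≤K | inj₁ t≤K = <⇒≢ s<t (∸-cancelˡ-≡ (≤-trans s≤K K≤a) (≤-trans t≤K K≤a)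
                                      (trans (sym (level-down s≤K)) (trans (cong level cs≡ct) (level-down t≤K))))
        ... | inj₂ K<s | inj₂ K<t = <⇒≢ s<t (∸-cancelʳ-≡ (<⇒≤ K<s) (<⇒≤ K<t) (+-cancelˡ-≡ j _ _
                                      (trans (sym (level-up K<s (≤-trans (<⇒≤ s<t) (≤-pred t<1+K+L))))
                                        (trans (cong level cs≡ct) (level-up K<t (≤-pred t<1+K+L))))))
        ... | inj₂ K<s | inj₁ t≤K = contradiction (<-trans K<s s<t) (≤⇒≯ t≤K)
        ... | inj₁ s≤K | inj₂ K<t = lastAgreement-last b (m<m+n j (m<n⇒0<n∸m K<t)) (up-index (≤-pred t<1+K+L))
                                      (trans (cong X (sym same-level)) (trans (sym (cycle-down s≤K)) (trans cs≡ct (cycle-up K<t))))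
          where
          same-level : a ∸ s ≡ j + (t ∸ K)
          same-level = trans (sym (level-down s≤K)) (trans (cong level cs≡ct) (level-up K<t (≤-pred t<1+K+L)))

        cycle-linked : ∀ {t} → suc t < suc (K + L) → Adj G (cycle t) (cycle (suc t))
        cycle-linked {t} 1+t<1+K+L with ≤-<-connex (suc t) K | ≤-<-connex t K
        ... | inj₁ 1+t≤K | _ rewrite cycle-down 1+t≤K | cycle-down (<⇒≤ 1+t≤K)
                                   | m>n⇒m∸n≡1+[m∸1+n] (<-≤-trans 1+t≤K K≤a) =
          adj-sym (X-adj (subst (_≤ a) (m>n⇒m∸n≡1+[m∸1+n] (<-≤-trans 1+t≤K K≤a)) (m∸n≤m a t)))
        ... | inj₂ K<1+t | inj₁ t≤K with ≤-antisym t≤K (≤-pred K<1+t)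
        ...   | refl rewrite cycle-down t≤K | cycle-up K<1+t | m∸[m∸n]≡n j≤a | Xj≡Yj
                           | m+n∸n≡m 1 K | +-comm j 1 = Y-adj j<b
        cycle-linked {t} 1+t<1+K+L | inj₂ K<1+t | inj₂ K<t
          rewrite cycle-up K<t | cycle-up K<1+t | +-∸-assoc 1 (<⇒≤ K<t) | +-suc j (t ∸ K) =
          Y-adj (subst (_≤ b) (+-suc j (t ∸ K)) (subst (λ i → j + i ≤ b) (+-∸-assoc 1 (<⇒≤ K<t)) (up-index (≤-pred 1+t<1+K+L))))

        not-bridged : ¬ Adj G (Y b) (X a)
        not-bridged Yb~Xa = sequence-not-closed cycle 2≤K+L cycle-injective cycle-linked closing
          where
          0<L : 0 < L
          0<L = m<n⇒0<n∸m j<b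
          2≤K+L : 2 ≤ K + L
          2≤K+L = +-mono-≤ (m<n⇒0<n∸m (<-≤-trans j<b b≤a)) 0<L
          closing : Adj G (cycle (K + L)) (cycle 0)
          closing rewrite cycle-up (m<m+n K 0<L) | cycle-down {0} z≤n
                        | m+n∸m≡n K L | m+[n∸m]≡n (<⇒≤ j<b) = Yb~Xa

    geodesics-not-bridged : ∀ {X Y : ℕ → Fin n} {a b} →
      (∀ {i} → i ≤ a → level (X i) ≡ i) → (∀ {i} → i ≤ b → level (Y i) ≡ i) →
      (∀ {i} → i < a → Adj G (X i) (X (suc i))) → (∀ {i} → i < b → Adj G (Y i) (Y (suc i))) →
      b ≤ a → X b ≢ Y b → ¬ Adj G (Y b) (X a)
    geodesics-not-bridged X-level Y-level X-adj Y-adj b≤a Xb≢Yb = Fork.not-bridged X-level Y-level X-adj Y-adj b≤a Xb≢Yb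

    geodesic-not-bridged : ∀ {x y} → level y ≤ level x → geodesic x (level y) ≢ y → ¬ Adj G y x
    geodesic-not-bridged {x} {y} ℓy≤ℓx X≢y y~x =
      geodesics-not-bridged {geodesic x} {geodesic y} geodesic-level geodesic-level geodesic-adj geodesic-adj ℓy≤ℓx
        (λ X≡Y → X≢y (trans X≡Y (geodesic-end y)))
        (subst₂ (Adj G) (sym (geodesic-end y)) (sym (geodesic-end x)) y~x)

    adj⇒level≢ : ∀ {x y} → Adj G x y → level x ≢ level y
    adj⇒level≢ {x} {y} x~y ℓx≡ℓy =
      geodesic-not-bridged (≤-reflexive (sym ℓx≡ℓy)) x≢y (adj-sym x~y)
      where
      x≢y : geodesic x (level y) ≢ y
      x≢y rewrite sym ℓx≡ℓy | geodesic-end x = λ { refl → subst T (Graph.irrefl G x) x~y }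

    parent-unique : ∀ {y u} → Adj G y u → level u ≡ suc (level y) → y ≡ parent u
    parent-unique {y} {u} y~u ℓu≡1+ℓy with parent u ≟ y
    ... | yes p≡y = sym p≡y
    ... | no  p≢y = contradiction y~u (geodesic-not-bridged (≤-trans (n≤1+n _) (≤-reflexive (sym ℓu≡1+ℓy))) g≢y)
      where
      g≢y : geodesic u (level y) ≢ y
      g≢y = p≢y ∘ trans (cong (λ j → ancestor j u) (sym ℓu∸ℓy≡1))
        where
        ℓu∸ℓy≡1 : level u ∸ level y ≡ 1
        ℓu∸ℓy≡1 = trans (cong (_∸ level y) ℓu≡1+ℓy) (m+n∸n≡m 1 (level y))

    adj⇒level≤1+level : ∀ {x y} → Adj G x y → level y ≤ suc (level x)
    adj⇒level≤1+level {x} {y} x~y = begin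
      level y                 ≤⟨ dist-triangle v x y ⟩
      level x + dist G x y    ≤⟨ +-monoʳ-≤ (level x) (dist-adj x~y) ⟩
      level x + 1             ≡⟨ +-comm (level x) 1 ⟩
      suc (level x)           ∎
      where open ≤-Reasoning

    adj⇒level-step : ∀ {x y} → Adj G x y → level y ≡ suc (level x) ⊎ level x ≡ suc (level y)
    adj⇒level-step {x} {y} x~y with <-cmp (level x) (level y)
    ... | tri< ℓx<ℓy _ _ = inj₁ (≤-antisym (adj⇒level≤1+level x~y) ℓx<ℓy)
    ... | tri≈ _ ℓx≡ℓy _ = contradiction ℓx≡ℓy (adj⇒level≢ x~y)
    ... | tri> _ _ ℓy<ℓx = inj₂ (≤-antisym (adj⇒level≤1+level (adj-sym x~y)) ℓy<ℓx)

  module OntoGeodesic (D : ℕ) (P : ℕ → Fin n) (P-adj : ∀ {i} → i < D → Adj G (P i) (P (suc i)))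
                      (P-geodesic : dist G (P 0) (P D) ≡ D) where

    reach-along : ∀ i k → i + k ≤ D → Reach k (P i) (P (i + k))
    reach-along i zero    _       = subst (λ j → Reach 0 (P i) (P j)) (sym (+-identityʳ i)) reach-refl
    reach-along i (suc k) i+k<D = subst (λ j → Reach (suc k) (P i) (P j)) (sym (+-suc i k))
      (reach-step (reach-along i k (≤-trans (+-monoʳ-≤ i (n≤1+n k)) i+k<D))
                  (P-adj (subst (_≤ D) (+-suc i k) i+k<D)))

    dist-along : ∀ {i j} → i ≤ j → j ≤ D → dist G (P i) (P j) ≤ j ∸ i
    dist-along {i} {j} i≤j j≤D = subst (λ l → dist G (P i) (P l) ≤ j ∸ i) (m+[n∸m]≡n i≤j)
      (dist-≤ (reach-along i (j ∸ i) (subst (_≤ D) (sym (m+[n∸m]≡n i≤j)) j≤D)))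

    dist-from-start : ∀ {i} → i ≤ D → dist G (P 0) (P i) ≡ i
    dist-from-start {i} i≤D = ≤-antisym (dist-along z≤n i≤D) (+-cancelʳ-≤ (D ∸ i) i _ (begin
      i + (D ∸ i)                               ≡⟨ m+[n∸m]≡n i≤D ⟩
      D                                         ≡⟨ P-geodesic ⟨
      dist G (P 0) (P D)                        ≤⟨ dist-triangle (P 0) (P i) (P D) ⟩
      dist G (P 0) (P i) + dist G (P i) (P D)   ≤⟨ +-monoʳ-≤ _ (dist-along i≤D ≤-refl) ⟩
      dist G (P 0) (P i) + (D ∸ i)              ∎))
      where open ≤-Reasoning

    private
      module FromVertex (u : Fin n) where
        open Rooted u using (adj⇒level-step; parent-unique)

        φ : ℕ → ℕ
        φ t = dist G u (P t)

        step : ∀ {t} → t < D → φ (suc t) ≡ suc (φ t) ⊎ φ t ≡ suc (φ (suc t))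
        step t<D = adj⇒level-step (P-adj t<D)

        -- Otherwise P t and P (t + 2) would both be the parent of P (t + 1).
        no-peak : ∀ {t} → suc t < D → φ (suc t) ≡ suc (φ t) → φ (suc t) ≢ suc (φ (suc (suc t)))
        no-peak {t} 1+t<D rise fall = <⇒≢ (≤-trans (n≤1+n (suc t)) ≤-refl) (begin
          t                                 ≡⟨ dist-from-start t≤D ⟨
          dist G (P 0) (P t)                ≡⟨ cong (dist G (P 0)) Pt≡Pt+2 ⟩
          dist G (P 0) (P (suc (suc t)))    ≡⟨ dist-from-start 1+t<D ⟩
          suc (suc t)                       ∎)
          where
          open ≡-Reasoning
          t≤D : t ≤ D
          t≤D = ≤-trans (n≤1+n t) (≤-trans (n≤1+n (suc t)) 1+t<D)
          Pt≡Pt+2 : P t ≡ P (suc (suc t))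
          Pt≡Pt+2 = trans (parent-unique (P-adj (<-trans (n<1+n t) 1+t<D)) rise)
                          (sym (parent-unique (adj-sym (P-adj 1+t<D)) fall))

        open Valley φ D step no-peak public

    -- Opaque, so that unification never unfolds the valley construction.
    opaque
      valley-at : ∀ u → Σ[ i ∈ ℕ ] (i ≤ D × (∀ {t} → t ≤ i → dist G u (P t) ≡ dist G u (P i) + (i ∸ t))
                                           × (∀ {t} → i ≤ t → t ≤ D → dist G u (P t) ≡ dist G u (P i) + (t ∸ i)))
      valley-at = FromVertex.valley

    projection : Fin n → ℕ
    projection u = proj₁ (valley-at u)

    height : Fin n → ℕ
    height u = dist G u (P (projection u))

    projection≤D : ∀ u → projection u ≤ D
    projection≤D u = proj₁ (proj₂ (valley-at u))

    dist-before : ∀ u {t} → t ≤ projection u → dist G u (P t) ≡ height u + (projection u ∸ t)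
    dist-before u = proj₁ (proj₂ (proj₂ (valley-at u)))

    dist-after : ∀ u {t} → projection u ≤ t → t ≤ D → dist G u (P t) ≡ height u + (t ∸ projection u)
    dist-after u = proj₂ (proj₂ (proj₂ (valley-at u)))

    height≡0⇒on-path : ∀ u → height u ≡ 0 → P (projection u) ≡ u
    height≡0⇒on-path u h≡0 = sym (dist≡0⇒≡ h≡0)

    projection-on-path : ∀ {t} → t ≤ D → projection (P t) ≡ t
    projection-on-path {t} t≤D with ≤-total t (projection (P t))
    ... | inj₁ t≤i = ≤-antisym (m∸n≡0⇒m≤n (m+n≡0⇒n≡0 (height (P t)) (trans (sym (dist-before (P t) t≤i)) (dist-refl (P t))))) t≤i
    ... | inj₂ i≤t = ≤-antisym i≤t (m∸n≡0⇒m≤n (m+n≡0⇒n≡0 (height (P t)) (trans (sym (dist-after (P t) i≤t t≤D)) (dist-refl (P t)))))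

    dist-to-ends : ∀ u → dist G u (P 0) + dist G u (P D) ≡ 2 * height u + D
    dist-to-ends u rewrite dist-before u {0} z≤n | dist-after u (projection≤D u) ≤-refl =
      trans (regroup (height u) (projection u) (D ∸ projection u)) (cong (2 * height u +_) (m+[n∸m]≡n (projection≤D u)))
      where
      regroup : ∀ h i r → (h + i) + (h + r) ≡ 2 * h + (i + r)
      regroup = solve-∀

    module _ (dist≤D : ∀ x y → dist G x y ≤ D) where

      height+projection≤D : ∀ u → height u + projection u ≤ D
      height+projection≤D u = subst (_≤ D) (dist-before u z≤n) (dist≤D u (P 0))

      height≤projection : ∀ u → height u ≤ projection u
      height≤projection u = subst (height u ≤_) (m∸[m∸n]≡n (projection≤D u))
        (m+n≤o⇒m≤o∸n (height u) (subst (_≤ D) (dist-after u (projection≤D u) ≤-refl) (dist≤D u (P D))))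

      dist-along-≤ : ∀ {t} → t ≤ D → ∀ w → dist G (P t) w ≤ t ⊔ (D ∸ t)
      dist-along-≤ {t} t≤D w rewrite dist-sym (P t) w with ≤-total t (projection w)
      ... | inj₁ t≤i rewrite dist-before w t≤i = ≤-trans (m+n≤o⇒m≤o∸n _ (begin
            height w + (projection w ∸ t) + t   ≡⟨ +-assoc (height w) _ t ⟩
            height w + (projection w ∸ t + t)   ≡⟨ cong (height w +_) (m∸n+n≡m t≤i) ⟩
            height w + projection w             ≤⟨ height+projection≤D w ⟩
            D                                   ∎)) (m≤n⊔m t (D ∸ t))
        where open ≤-Reasoning
      ... | inj₂ i≤t rewrite dist-after w i≤t t≤D = ≤-trans (begin
            height w + (t ∸ projection w)       ≤⟨ +-monoˡ-≤ _ (height≤projection w) ⟩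
            projection w + (t ∸ projection w)   ≡⟨ m+[n∸m]≡n i≤t ⟩
            t                                   ∎) (m≤m⊔n t (D ∸ t))
        where open ≤-Reasoning

module PathGraph (N : ℕ) where
  private
    n = suc N
  open Walks (pathGraph n)

  path-adj⇒∣-∣≡1 : ∀ {i j} → Adj (pathGraph n) i j → ∣ toℕ i - toℕ j ∣ ≡ 1
  path-adj⇒∣-∣≡1 {i} {j} i~j with Equivalence.to (T-∨ {suc (toℕ i) ℕ.≡ᵇ toℕ j}) i~j
  ... | inj₁ 1+i≡j = trans (cong (∣ toℕ i -_∣) (sym (≡ᵇ⇒≡ (suc (toℕ i)) (toℕ j) 1+i≡j))) (∣m-1+m∣≡1 (toℕ i))
  ... | inj₂ 1+j≡i = trans (cong (∣_- toℕ j ∣) (sym (≡ᵇ⇒≡ (suc (toℕ j)) (toℕ i) 1+j≡i)))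
                           (trans (∣-∣-comm (suc (toℕ j)) (toℕ j)) (∣m-1+m∣≡1 (toℕ j)))

  reach⇒∣-∣≤ : ∀ {k i j} → Reach k i j → ∣ toℕ i - toℕ j ∣ ≤ k
  reach⇒∣-∣≤ {zero} {i} {j} r rewrite reach-zero⁻ r = ≤-reflexive (∣n-n∣≡0 (toℕ j))
  reach⇒∣-∣≤ {suc k} {i} {j} r with reach-suc⁻ r
  ... | inj₁ r′ = m≤n⇒m≤1+n (reach⇒∣-∣≤ r′)
  ... | inj₂ (w , r′ , w~j) = begin
    ∣ toℕ i - toℕ j ∣                       ≤⟨ ∣-∣-triangle (toℕ i) (toℕ w) (toℕ j) ⟩
    ∣ toℕ i - toℕ w ∣ + ∣ toℕ w - toℕ j ∣   ≤⟨ +-mono-≤ (reach⇒∣-∣≤ {k} {i} {w} r′) (≤-reflexive (path-adj⇒∣-∣≡1 {w} {j} w~j)) ⟩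
    k + 1                                   ≡⟨ +-comm k 1 ⟩
    suc k                                   ∎
    where open ≤-Reasoning

  reach-upward : ∀ k (i j : Fin n) → toℕ j ≡ toℕ i + k → Reach k i j
  reach-upward zero    i j j≡i+0 = subst (Reach 0 i) (Finₚ.toℕ-injective (trans (sym (+-identityʳ (toℕ i))) (sym j≡i+0))) reach-refl
  reach-upward (suc k) i j j≡i+1+k = reach-step (reach-upward k i w (Finₚ.toℕ-fromℕ< w<n))
    (Equivalence.from T-∨ (inj₁ (≡⇒≡ᵇ _ _ (trans (cong suc (Finₚ.toℕ-fromℕ< w<n)) (trans (sym (+-suc (toℕ i) k)) (sym j≡i+1+k))))))
    where
    w<n : toℕ i + k < n
    w<n = <-trans (n<1+n _) (subst (_< n) (trans j≡i+1+k (+-suc (toℕ i) k)) (Finₚ.toℕ<n j))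
    w : Fin n
    w = Fin.fromℕ< w<n

  reach-∣-∣ : ∀ i j → Reach ∣ toℕ i - toℕ j ∣ i j
  reach-∣-∣ i j with ≤-total (toℕ i) (toℕ j)
  ... | inj₁ i≤j rewrite m≤n⇒∣m-n∣≡n∸m i≤j = reach-upward _ i j (sym (m+[n∸m]≡n i≤j))
  ... | inj₂ j≤i rewrite m≤n⇒∣n-m∣≡n∸m j≤i = reach-sym (reach-upward _ j i (sym (m+[n∸m]≡n j≤i)))

  path-connected : Connected (pathGraph n)
  path-connected i j = ∣ toℕ i - toℕ j ∣ , Reach.unreach (reach-∣-∣ i j)

  open Distances (pathGraph n) path-connected using (reach-dist)

  path-dist : ∀ i j → dist (pathGraph n) i j ≡ ∣ toℕ i - toℕ j ∣
  path-dist i j = ≤-antisym (dist-≤ (reach-∣-∣ i j)) (reach⇒∣-∣≤ (reach-dist i j))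

  path-ecc-≥ : ∀ v → toℕ v ⊔ (N ∸ toℕ v) ≤ ecc (pathGraph n) v
  path-ecc-≥ v = ⊔-lub (≤-trans (≤-reflexive to-start) (maxV-upper (pathGraph n) (dist (pathGraph n) v) zero))
                       (≤-trans (≤-reflexive to-end) (maxV-upper (pathGraph n) (dist (pathGraph n) v) (Fin.fromℕ N)))
    where
    to-start : toℕ v ≡ dist (pathGraph n) v zero
    to-start = sym (trans (path-dist v zero) (∣-∣-identityʳ (toℕ v)))
    to-end : N ∸ toℕ v ≡ dist (pathGraph n) v (Fin.fromℕ N)
    to-end = sym (begin
      dist (pathGraph n) v (Fin.fromℕ N)   ≡⟨ path-dist v (Fin.fromℕ N) ⟩
      ∣ toℕ v - toℕ (Fin.fromℕ N) ∣        ≡⟨ cong (∣ toℕ v -_∣) (Finₚ.toℕ-fromℕ N) ⟩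
      ∣ toℕ v - N ∣                        ≡⟨ m≤n⇒∣m-n∣≡n∸m (Finₚ.toℕ≤pred[n] v) ⟩
      N ∸ toℕ v                            ∎)
      where open ≡-Reasoning

  path-eccSum-≥ : pathEccSum N ≤ sumV (pathGraph n) (ecc (pathGraph n))
  path-eccSum-≥ = ≤-trans (∑-mono-≤ path-ecc-≥) (≤-reflexive (sym (sumV≡∑ (pathGraph n) (ecc (pathGraph n)))))

  path-transmission-≤ : ∀ v → 2 * transmission (pathGraph n) v ≤ n * N
  path-transmission-≤ v = begin
    2 * transmission (pathGraph n) v          ≡⟨ cong (2 *_) (sumV≡∑ (pathGraph n) (dist (pathGraph n) v)) ⟩
    2 * ∑[ u < n ] dist (pathGraph n) v u     ≡⟨ cong (2 *_) (sum-cong-≗ (path-dist v)) ⟩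
    2 * ∑[ u < n ] ∣ toℕ v - toℕ u ∣          ≤⟨ ∑-∣-∣-≤ (Finₚ.toℕ≤pred[n] v) ⟩
    n * N                                     ∎
    where open ≤-Reasoning

  half-nN : ℕ
  half-nN = n * N ℕ./ 2

  path-transmission-≤-half : ∀ v → transmission (pathGraph n) v ≤ half-nN
  path-transmission-≤-half v = subst (_≤ half-nN) (ℕ÷.m*n/n≡m (transmission (pathGraph n) v) 2)
    (ℕ÷./-monoˡ-≤ 2 (subst (_≤ n * N) (*-comm 2 (transmission (pathGraph n) v)) (path-transmission-≤ v)))

  2*half-nN≤nN : 2 * half-nN ≤ n * N
  2*half-nN≤nN = subst (_≤ n * N) (*-comm half-nN 2) (ℕ÷.m/n*n≤m (n * N) 2)

module DiametricTree {m} (G : Graph (suc (suc m))) (tree : IsTree G)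
                     (p : Fin (suc (diam G)) → Fin (suc (suc m))) (diametric : IsDiametricPath G p) where
  private
    n N D : ℕ
    n = suc (suc m)
    N = suc m
    D = diam G

  open Trees G tree

  -- The diametric path indexed by ℕ, constant beyond its end.
  P : ℕ → Fin n
  P i = p (Fin.fromℕ< (s≤s (m⊓n≤n i D)))

  P-toℕ : ∀ j → P (toℕ j) ≡ p j
  P-toℕ j = cong p (Finₚ.toℕ-injective (trans (Finₚ.toℕ-fromℕ< _) (m≤n⇒m⊓n≡m (Finₚ.toℕ≤pred[n] j))))

  P-adj : ∀ {i} → i < D → Adj G (P i) (P (suc i))
  P-adj {i} i<D = subst₂ (Adj G) (trans (sym (P-toℕ (Fin.inject₁ j))) (cong P (trans (Finₚ.toℕ-inject₁ j) toℕj≡i)))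
                                  (trans (sym (P-toℕ (suc j))) (cong (P ∘ suc) toℕj≡i))
                                  (proj₁ diametric j)
    where
    j = Fin.fromℕ< i<D
    toℕj≡i : toℕ j ≡ i
    toℕj≡i = Finₚ.toℕ-fromℕ< i<D

  P-geodesic : dist G (P 0) (P D) ≡ D
  P-geodesic = subst₂ (λ x y → dist G x y ≡ D) (sym (P-toℕ zero))
                 (trans (sym (P-toℕ (Fin.fromℕ D))) (cong P (Finₚ.toℕ-fromℕ D))) (proj₂ diametric)

  dist≤D : ∀ x y → dist G x y ≤ D
  dist≤D x y = ≤-trans (maxV-upper G (dist G x) y) (maxV-upper G (ecc G) x)

  open OntoGeodesic D P P-adj P-geodesic

  proj : Fin n → Fin (suc D)
  proj u = Fin.fromℕ< (s≤s (projection≤D u))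

  toℕ-proj : ∀ u → toℕ (proj u) ≡ projection u
  toℕ-proj u = Finₚ.toℕ-fromℕ< _

  proj-p : ∀ j → proj (p j) ≡ j
  proj-p j = Finₚ.toℕ-injective (begin
    toℕ (proj (p j))          ≡⟨ toℕ-proj (p j) ⟩
    projection (p j)          ≡⟨ cong projection (P-toℕ j) ⟨
    projection (P (toℕ j))    ≡⟨ projection-on-path (Finₚ.toℕ≤pred[n] j) ⟩
    toℕ j                     ∎)
    where open ≡-Reasoning

  onPath? : ∀ u → Dec (p (proj u) ≡ u)
  onPath? u = p (proj u) ≟ u

  offPath : Fin n → ℕ
  offPath u = if does (onPath? u) then 0 else 1

  offPathCount : ℕ
  offPathCount = ∑[ u < n ] offPath u

  off⇒height≢0 : ∀ {u} → ¬ p (proj u) ≡ u → height u ≢ 0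
  off⇒height≢0 {u} off h≡0 = off (trans (sym (trans (cong P (sym (toℕ-proj u))) (P-toℕ (proj u)))) (height≡0⇒on-path u h≡0))

  D+offPathCount≡N : D + offPathCount ≡ N
  D+offPathCount≡N = suc-injective (begin
    suc D + offPathCount                                         ≡⟨ cong (_+ offPathCount) on-count ⟨
    ∑[ u < n ] onPath u + offPathCount                           ≡⟨ ∑-distrib-+ onPath offPath ⟨
    ∑[ u < n ] (onPath u + offPath u)                            ≡⟨ sum-cong-≗ (λ u → one (does (onPath? u))) ⟩
    ∑[ u < n ] 1                                                 ≡⟨ trans (∑-const n 1) (*-identityʳ n) ⟩
    n                                                            ∎)
    where
    open ≡-Reasoning
    onPath : Fin n → ℕ
    onPath u = if does (onPath? u) then 1 else 0
    on-count : ∑[ u < n ] onPath u ≡ suc D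
    on-count = trans (∑-over-image p proj proj-p (λ _ → 1)) (trans (∑-const (suc D) 1) (*-identityʳ (suc D)))
    one : ∀ b → (if b then 1 else 0) + (if b then 0 else 1) ≡ 1
    one true  = refl
    one false = refl

  ecc-on-path : ∀ j → ecc G (p j) ≤ toℕ j ⊔ (D ∸ toℕ j)
  ecc-on-path j = subst (λ x → ecc G x ≤ toℕ j ⊔ (D ∸ toℕ j)) (P-toℕ j)
                        (maxV-lub G (dist-along-≤ dist≤D (Finₚ.toℕ≤pred[n] j)))

  onPathEcc : Fin n → ℕ
  onPathEcc u = if does (onPath? u) then toℕ (proj u) ⊔ (D ∸ toℕ (proj u)) else 0

  ecc-≤ : ∀ u → ecc G u ≤ onPathEcc u + D * offPath u
  ecc-≤ u = by-cases (onPath? u)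
    where
    M = toℕ (proj u) ⊔ (D ∸ toℕ (proj u))
    by-cases : (on? : Dec (p (proj u) ≡ u)) → ecc G u ≤ (if does on? then M else 0) + D * (if does on? then 0 else 1)
    by-cases (yes on) = subst₂ _≤_ (cong (ecc G) on) (sym (trans (cong (M +_) (*-zeroʳ D)) (+-identityʳ M)))
                               (ecc-on-path (proj u))
    by-cases (no  _)  = subst (ecc G u ≤_) (sym (*-identityʳ D)) (maxV-upper G (ecc G) u)

  eccSum-≤ : sumV G (ecc G) ≤ pathEccSum D + offPathCount * D
  eccSum-≤ = begin
    sumV G (ecc G)                                       ≡⟨ sumV≡∑ G (ecc G) ⟩
    ∑[ u < n ] ecc G u                                   ≤⟨ ∑-mono-≤ ecc-≤ ⟩
    ∑[ u < n ] (onPathEcc u + D * offPath u)             ≡⟨ ∑-distrib-+ onPathEcc (λ u → D * offPath u) ⟩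
    ∑[ u < n ] onPathEcc u + ∑[ u < n ] (D * offPath u)  ≡⟨ cong₂ _+_ (∑-over-image p proj proj-p (λ j → toℕ j ⊔ (D ∸ toℕ j)))
                                                                      (sym (*-distribˡ-sum D offPath)) ⟩
    pathEccSum D + D * offPathCount                      ≡⟨ cong (pathEccSum D +_) (*-comm D offPathCount) ⟩
    pathEccSum D + offPathCount * D                      ∎
    where open ≤-Reasoning

  ends-≤ : ∀ u → D + 2 * offPath u ≤ dist G (P 0) u + dist G (P D) u
  ends-≤ u = begin
    D + 2 * offPath u                   ≤⟨ by-cases (onPath? u) ⟩
    2 * height u + D                    ≡⟨ dist-to-ends u ⟨
    dist G u (P 0) + dist G u (P D)     ≡⟨ cong₂ _+_ (dist-sym u (P 0)) (dist-sym u (P D)) ⟩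
    dist G (P 0) u + dist G (P D) u     ∎
    where
    open ≤-Reasoning
    by-cases : (on? : Dec (p (proj u) ≡ u)) → D + 2 * (if does on? then 0 else 1) ≤ 2 * height u + D
    by-cases (yes _)   = ≤-trans (≤-reflexive (+-identityʳ D)) (m≤n+m D (2 * height u))
    by-cases (no  off) = subst (_≤ 2 * height u + D) (+-comm 2 D)
                           (+-monoˡ-≤ D (*-monoʳ-≤ 2 (n≢0⇒n>0 (off⇒height≢0 off))))

  transmission-ends : ℕ
  transmission-ends = transmission G (P 0) ⊔ transmission G (P D)

  transmission-ends-≥ : n * D + 2 * offPathCount ≤ 2 * transmission-ends
  transmission-ends-≥ = begin
    n * D + 2 * offPathCount                           ≡⟨ cong₂ _+_ (sym (∑-const n D))
                                                                    (*-distribˡ-sum 2 offPath) ⟩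
    ∑[ u < n ] D + ∑[ u < n ] (2 * offPath u)          ≡⟨ ∑-distrib-+ (λ _ → D) (λ u → 2 * offPath u) ⟨
    ∑[ u < n ] (D + 2 * offPath u)                     ≤⟨ ∑-mono-≤ ends-≤ ⟩
    ∑[ u < n ] (dist G (P 0) u + dist G (P D) u)       ≡⟨ ∑-distrib-+ (dist G (P 0)) (dist G (P D)) ⟩
    ∑[ u < n ] dist G (P 0) u + ∑[ u < n ] dist G (P D) u
                                                       ≡⟨ cong₂ _+_ (sumV≡∑ G (dist G (P 0))) (sumV≡∑ G (dist G (P D))) ⟨
    t₀ + t₁                                            ≤⟨ +-mono-≤ (m≤m⊔n t₀ t₁) (m≤n⊔m t₀ t₁) ⟩
    transmission-ends + transmission-ends              ≡⟨ cong (transmission-ends +_) (+-identityʳ transmission-ends) ⟨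
    2 * transmission-ends                              ∎
    where
    open ≤-Reasoning
    t₀ = transmission G (P 0)
    t₁ = transmission G (P D)

  transmission-ends≤remoteness : (ℤ.+ transmission-ends) Q./ N Q.≤ remoteness G
  transmission-ends≤remoteness =
    ⊔-preserves (λ t → (ℤ.+ t) Q./ N Q.≤ remoteness G) {transmission G (P 0)} {transmission G (P D)}
      (normTrans≤remoteness G (P 0)) (normTrans≤remoteness G (P D))

path-remoteness-≤ : ∀ m → remoteness (pathGraph (suc (suc m))) Q.≤ (ℤ.+ PathGraph.half-nN (suc m)) Q./ suc m
path-remoteness-≤ m = remoteness-lub (pathGraph (suc (suc m))) (Fractions.0≤/ half-nN m)
  (λ v → Fractions./-monoˡ-≤ m (path-transmission-≤-half v))
  where open PathGraph (suc m) using (half-nN; path-transmission-≤-half)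

lemma11 : (m : ℕ) (G : Graph (suc (suc m))) → IsTree G
    → (p : Fin (suc (diam G)) → Fin (suc (suc m))) → IsDiametricPath G p
    → (∃ λ j → (2 * j ≤ diam G) × (∀ (k : Fin (suc (diam G))) → suc j ≤ toℕ k → deg G (p k) ≤ 2))
    → avgEcc G - remoteness G Q.≤ avgEcc (pathGraph (suc (suc m))) - remoteness (pathGraph (suc (suc m)))
lemma11 m G tree p diametric _ =
  Fractions.difference-mono-≤ {sumV G (ecc G)} {half-nN} {sumV Pₙ (ecc Pₙ)} {transmission-ends} (suc m) m
    (cross-multiplied-bound {diam G} {offPathCount} {t = transmission-ends} {x = half-nN}
       D+offPathCount≡N eccSum-≤ path-eccSum-≥ transmission-ends-≥ 2*half-nN≤nN)
    transmission-ends≤remoteness (path-remoteness-≤ m)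
  where
  open DiametricTree G tree p diametric
  open PathGraph (suc m) using (half-nN; 2*half-nN≤nN; path-eccSum-≥)
  Pₙ = pathGraph (suc (suc m))
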